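{- (i) For every integer $n$ there is a connected graph $G$ such that $D_i(G,-1)=n$. (ii) For every negative integer $n$ there is a connected graph $G$ such that $n$ is an independence domination root of $G$, i.e. $D_i(G,n)=0$.
   Context: All graphs are finite and simple. A set $S\subseteq V(G)$ is an independent dominating set of $G$ if no two vertices of $S$ are adjacent and every vertex of $V(G)\setminus S$ has a neighbour in $S$. Let $d_i(G,k)$ be the number of independent dominating sets of $G$ of cardinality $k$, and let the independent domination polynomial be $D_i(G,x)=\sum_{k} d_i(G,k)x^k$. An independence domination root of $G$ is a (complex) root of $D_i(G,x)$. -}

module Defs where

open import Data.Nat using (ℕ; zero; suc)
open import Data.Bool using (Bool; true; false)
open import Data.Fin using (Fin)
open import Data.Fin.Subset using (Subset; _∈_; _∉_; ∣_∣; inside; outside)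
open import Data.Fin.Subset.Properties using (_∈?_)
open import Data.Fin.Properties using (all?; any?)
open import Data.Vec using (_∷_; [])
open import Data.List using (List; []; _∷_; map; _++_; filter; foldr)
open import Data.Integer using (ℤ; _*_; _+_; +_)
open import Data.Product using (_×_; Σ; _,_)
open import Data.Unit using (⊤)
open import Relation.Nullary using (¬_; Dec; yes; no)
open import Relation.Nullary.Decidable using (_×-dec_; _→-dec_; ¬?)
open import Relation.Binary.PropositionalEquality using (_≡_)

record Graph (n : ℕ) : Set where
  field
    adj   : Fin n → Fin n → Bool
    sym   : ∀ u v → adj u v ≡ adj v u
    irrefl : ∀ v → adj v v ≡ false

open Graph public

Adj : ∀ {n} → Graph n → Fin n → Fin n → Set
Adj G u v = adj G u v ≡ true

data Walk {n : ℕ} (G : Graph n) : Fin n → Fin n → Set where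
  here  : ∀ {v} → Walk G v v
  step  : ∀ {u w v} → Adj G u w → Walk G w v → Walk G u v

Connected : ∀ {n} → Graph n → Set
Connected {n} G = Σ (Fin n) (λ _ → ⊤) × (∀ u v → Walk G u v)

Independent : ∀ {n} → Graph n → Subset n → Set
Independent {n} G S = ∀ (u v : Fin n) → u ∈ S → v ∈ S → ¬ Adj G u v

Dominating : ∀ {n} → Graph n → Subset n → Set
Dominating {n} G S = ∀ (v : Fin n) → v ∉ S → Σ (Fin n) (λ u → u ∈ S × Adj G v u)

IndepDominating : ∀ {n} → Graph n → Subset n → Set
IndepDominating G S = Independent G S × Dominating G S

private
  adj? : ∀ {n} (G : Graph n) u v → Dec (Adj G u v)
  adj? G u v with adj G u v
  ... | true  = yes _≡_.refl
  ... | false = no (λ ())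

  exists? : ∀ {n} (P : Fin n → Set) → (∀ u → Dec (P u)) → Dec (Σ (Fin n) P)
  exists? P P? = any? P?

indepDominating? : ∀ {n} (G : Graph n) (S : Subset n) → Dec (IndepDominating G S)
indepDominating? G S =
  all? (λ u → all? (λ v → (u ∈? S) →-dec ((v ∈? S) →-dec ¬? (adj? G u v))))
  ×-dec all? (λ v → ¬? (v ∈? S) →-dec any? (λ u → (u ∈? S) ×-dec adj? G v u))

allSubsets : ∀ n → List (Subset n)
allSubsets zero = [] ∷ []
allSubsets (suc n) = map (outside ∷_) (allSubsets n) ++ map (inside ∷_) (allSubsets n)

_^ᶻ_ : ℤ → ℕ → ℤ
x ^ᶻ zero = + 1
x ^ᶻ suc k = x * (x ^ᶻ k)

-- the independent domination polynomial evaluated at an integer x: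
-- D_i(G,x) = Σ_{S independent dominating} x^|S| = Σ_k d_i(G,k) x^k
Di : ∀ {n} → Graph n → ℤ → ℤ
Di {n} G x = foldr _+_ (+ 0) (map (λ S → x ^ᶻ ∣ S ∣) (filter (indepDominating? G) (allSubsets n)))

module Submission where

open import Defs
open import Data.Nat using (ℕ)
open import Data.Integer using (ℤ; -_; +_; -[1+_])
open import Data.Product using (Σ; _×_)
open import Relation.Binary.PropositionalEquality using (_≡_)

-- The join G ∨ H of two graphs (disjoint union plus every edge
-- between the two parts) satisfies D_i(G ∨ H, x) = D_i(G, x) + D_i(H, x)
-- when G and H are nonempty: an independent set of G ∨ H cannot meet both
-- parts, and a nonempty independent set inside one part dominates the whole
-- other part.  The edgeless graph on n vertices has D_i = x^n.  Hence the path
-- P₃ = Ē₂ ∨ K₁ has D_i(P₃, x) = x² + x, which vanishes at x = -1, and joining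
-- k copies of H on top of P₃ gives the connected graph with polynomial
-- k·D_i(H, x) + x² + x.  With H = Ē₂ resp. H = K₁ this realises every integer
-- as D_i(G, -1), and with H = K₁ the polynomial kx + x² + x has the root -(k+1).

open import Data.Nat as N using (zero; suc)
open import Data.Integer using (_+_; _-_; _*_)
import Data.Integer.Properties as ℤP
open import Data.Integer.Tactic.RingSolver using (solve-∀)
open import Data.Bool using (Bool; true; false; if_then_else_)
open import Data.Sum using (_⊎_; inj₁; inj₂)
open import Data.Product using (_,_; proj₂)
open import Data.Unit using (tt)
open import Data.Empty using (⊥-elim)
open import Data.Fin using (Fin; zero; suc; splitAt; _↑ˡ_; _↑ʳ_)
open import Data.Fin.Properties using (splitAt-↑ˡ; splitAt-↑ʳ; splitAt⁻¹-↑ˡ; splitAt⁻¹-↑ʳ)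
open import Data.Fin.Subset using (Subset; _∈_; _∉_; ∣_∣; inside; outside; ⊥; ⊤; Nonempty)
open import Data.Fin.Subset.Properties
  using (_∈?_; ∣⊥∣≡0; ∣⊤∣≡n; ∉⊥; ∈⊤; drop-there; Empty-unique; nonempty?)
open import Data.Vec using ([]; _∷_; _++_)
open import Data.Vec.Properties using (∷-injectiveʳ; lookup-++ˡ; lookup-++ʳ; []=⇒lookup; lookup⇒[]=)
open import Data.List using (List; []; _∷_; map; filter; foldr) renaming (_++_ to _++ₗ_)
open import Data.List.Properties using (map-++; map-∘; map-cong)
open import Function using (_∘_)
open import Function.Bundles using (_⇔_; mk⇔; Equivalence)
open import Relation.Nullary using (¬_; yes; no; does)
open import Relation.Nullary.Decidable using (dec-true; dec-false)
open import Relation.Unary using (Pred; Decidable)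
open import Level using (0ℓ)
open import Relation.Binary.PropositionalEquality
  using (_≢_; refl; trans; cong; cong₂; subst; module ≡-Reasoning)
  renaming (sym to ≡-sym)
open ≡-Reasoning
open Equivalence using (to; from)

sumℤ : List ℤ → ℤ
sumℤ = foldr _+_ (+ 0)

sumℤ-++ : ∀ xs ys → sumℤ (xs ++ₗ ys) ≡ sumℤ xs + sumℤ ys
sumℤ-++ [] ys = ≡-sym (ℤP.+-identityˡ _)
sumℤ-++ (x ∷ xs) ys = trans (cong (λ t → x + t) (sumℤ-++ xs ys)) (≡-sym (ℤP.+-assoc x _ _))

sumℤ-filter : ∀ {A : Set} {P : Pred A 0ℓ} (P? : Decidable P) (f : A → ℤ) xs →
  sumℤ (map f (filter P? xs)) ≡ sumℤ (map (λ a → if does (P? a) then f a else + 0) xs)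
sumℤ-filter P? f [] = refl
sumℤ-filter P? f (x ∷ xs) with does (P? x)
... | true  = cong (λ t → f x + t) (sumℤ-filter P? f xs)
... | false = trans (sumℤ-filter P? f xs) (≡-sym (ℤP.+-identityˡ _))

sumℤ-map-+ : ∀ {A : Set} (f g : A → ℤ) xs →
  sumℤ (map (λ a → f a + g a) xs) ≡ sumℤ (map f xs) + sumℤ (map g xs)
sumℤ-map-+ f g [] = refl
sumℤ-map-+ f g (x ∷ xs) =
  trans (cong (λ t → f x + g x + t) (sumℤ-map-+ f g xs)) (interchange (f x) (g x) _ _)
  where
  interchange : ∀ a b c d → (a + b) + (c + d) ≡ (a + c) + (b + d)
  interchange = solve-∀

subsetSum : ∀ n → (Subset n → ℤ) → ℤ
subsetSum n f = sumℤ (map f (allSubsets n))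

subsetSum-cong : ∀ n {f g : Subset n → ℤ} → (∀ S → f S ≡ g S) → subsetSum n f ≡ subsetSum n g
subsetSum-cong n f≗g = cong sumℤ (map-cong f≗g (allSubsets n))

subsetSum-+ : ∀ n (f g : Subset n → ℤ) →
  subsetSum n (λ S → f S + g S) ≡ subsetSum n f + subsetSum n g
subsetSum-+ n f g = sumℤ-map-+ f g (allSubsets n)

subsetSum-suc : ∀ n (f : Subset (suc n) → ℤ) →
  subsetSum (suc n) f ≡ subsetSum n (λ S → f (outside ∷ S)) + subsetSum n (λ S → f (inside ∷ S))
subsetSum-suc n f = begin
    sumℤ (map f (map (outside ∷_) A ++ₗ map (inside ∷_) A))
  ≡⟨ cong sumℤ (map-++ f (map (outside ∷_) A) (map (inside ∷_) A)) ⟩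
    sumℤ (map f (map (outside ∷_) A) ++ₗ map f (map (inside ∷_) A))
  ≡⟨ sumℤ-++ (map f (map (outside ∷_) A)) (map f (map (inside ∷_) A)) ⟩
    sumℤ (map f (map (outside ∷_) A)) + sumℤ (map f (map (inside ∷_) A))
  ≡⟨ ≡-sym (cong₂ _+_ (cong sumℤ (map-∘ {g = f} {f = outside ∷_} A))
                       (cong sumℤ (map-∘ {g = f} {f = inside ∷_} A))) ⟩
    subsetSum n (λ S → f (outside ∷ S)) + subsetSum n (λ S → f (inside ∷ S)) ∎
  where
  A = allSubsets n

subsetSum-++ : ∀ m n (f : Subset (m N.+ n) → ℤ) →
  subsetSum (m N.+ n) f ≡ subsetSum m (λ S → subsetSum n (λ T → f (S ++ T)))
subsetSum-++ zero n f = ≡-sym (ℤP.+-identityʳ _)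
subsetSum-++ (suc m) n f = begin
    subsetSum (suc (m N.+ n)) f
  ≡⟨ subsetSum-suc (m N.+ n) f ⟩
    subsetSum (m N.+ n) (λ S → f (outside ∷ S)) + subsetSum (m N.+ n) (λ S → f (inside ∷ S))
  ≡⟨ cong₂ _+_ (subsetSum-++ m n (λ S → f (outside ∷ S))) (subsetSum-++ m n (λ S → f (inside ∷ S))) ⟩
    subsetSum m (λ S → subsetSum n (λ T → f (outside ∷ S ++ T)))
      + subsetSum m (λ S → subsetSum n (λ T → f (inside ∷ S ++ T)))
  ≡⟨ ≡-sym (subsetSum-suc m (λ S → subsetSum n (λ T → f (S ++ T)))) ⟩
    subsetSum (suc m) (λ S → subsetSum n (λ T → f (S ++ T))) ∎

subsetSum-point : ∀ n (P : Subset n) (f : Subset n → ℤ) →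
  (∀ S → S ≢ P → f S ≡ + 0) → subsetSum n f ≡ f P
subsetSum-point zero [] f vanish = ℤP.+-identityʳ (f [])
subsetSum-point (suc n) (b ∷ P) f vanish = begin
    subsetSum (suc n) f
  ≡⟨ subsetSum-suc n f ⟩
    subsetSum n (λ S → f (outside ∷ S)) + subsetSum n (λ S → f (inside ∷ S))
  ≡⟨ cong₂ _+_ (branch outside) (branch inside) ⟩
    f (outside ∷ P) + f (inside ∷ P)
  ≡⟨ onlyHead b vanish ⟩
    f (b ∷ P) ∎
  where
  branch : ∀ c → subsetSum n (λ S → f (c ∷ S)) ≡ f (c ∷ P)
  branch c = subsetSum-point n P (λ S → f (c ∷ S)) (λ S S≢P → vanish (c ∷ S) (S≢P ∘ ∷-injectiveʳ))
  onlyHead : ∀ c → (∀ S → S ≢ c ∷ P → f S ≡ + 0) → f (outside ∷ P) + f (inside ∷ P) ≡ f (c ∷ P)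
  onlyHead outside vanish′ = trans (cong (λ t → f (outside ∷ P) + t) (vanish′ _ (λ ()))) (ℤP.+-identityʳ _)
  onlyHead inside  vanish′ = trans (cong (_+ f (inside ∷ P)) (vanish′ _ (λ ()))) (ℤP.+-identityˡ _)

subsetSum-cross : ∀ m n (f : Subset m → Subset n → ℤ) →
  (∀ S T → S ≢ ⊥ → T ≢ ⊥ → f S T ≡ + 0) →
  subsetSum m (λ S → subsetSum n (f S)) ≡ subsetSum m (λ S → f S ⊥) + subsetSum n (f ⊥) - f ⊥ ⊥
subsetSum-cross m n f cross = begin
    subsetSum m row
  ≡⟨ subsetSum-cong m (λ S → decompose (row S) (f S ⊥)) ⟩
    subsetSum m (λ S → f S ⊥ + excess S)
  ≡⟨ subsetSum-+ m (λ S → f S ⊥) excess ⟩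
    subsetSum m (λ S → f S ⊥) + subsetSum m excess
  ≡⟨ cong (λ t → subsetSum m (λ S → f S ⊥) + t) (subsetSum-point m ⊥ excess excess-vanishes) ⟩
    subsetSum m (λ S → f S ⊥) + (subsetSum n (f ⊥) - f ⊥ ⊥)
  ≡⟨ ≡-sym (ℤP.+-assoc (subsetSum m (λ S → f S ⊥)) (subsetSum n (f ⊥)) (- f ⊥ ⊥)) ⟩
    subsetSum m (λ S → f S ⊥) + subsetSum n (f ⊥) - f ⊥ ⊥ ∎
  where
  row : Subset m → ℤ
  row S = subsetSum n (f S)
  excess : Subset m → ℤ
  excess S = row S - f S ⊥
  decompose : ∀ r e → r ≡ e + (r - e)
  decompose = solve-∀
  excess-vanishes : ∀ S → S ≢ ⊥ → excess S ≡ + 0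
  excess-vanishes S S≢⊥ = begin
      row S - f S ⊥
    ≡⟨ cong (_- f S ⊥) (subsetSum-point n ⊥ (f S) (λ T → cross S T S≢⊥)) ⟩
      f S ⊥ - f S ⊥
    ≡⟨ ℤP.+-inverseʳ (f S ⊥) ⟩
      + 0 ∎

weight : ∀ {n} → Graph n → ℤ → Subset n → ℤ
weight G x S = if does (indepDominating? G S) then x ^ᶻ ∣ S ∣ else + 0

Di-as-subsetSum : ∀ {n} (G : Graph n) x → Di G x ≡ subsetSum n (weight G x)
Di-as-subsetSum {n} G x = sumℤ-filter (indepDominating? G) (λ S → x ^ᶻ ∣ S ∣) (allSubsets n)

weight-yes : ∀ {n} (G : Graph n) x {S} → IndepDominating G S → weight G x S ≡ x ^ᶻ ∣ S ∣
weight-yes G x {S} s =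
  cong (λ b → if b then x ^ᶻ ∣ S ∣ else + 0) (dec-true (indepDominating? G S) s)

weight-no : ∀ {n} (G : Graph n) x {S} → ¬ IndepDominating G S → weight G x S ≡ + 0
weight-no G x {S} ¬s =
  cong (λ b → if b then x ^ᶻ ∣ S ∣ else + 0) (dec-false (indepDominating? G S) ¬s)

weight-transfer : ∀ {m n} (G : Graph m) (H : Graph n) x {S T} →
  IndepDominating G S ⇔ IndepDominating H T → ∣ S ∣ ≡ ∣ T ∣ → weight G x S ≡ weight H x T
weight-transfer G H x {S} {T} S⇔T size with indepDominating? G S
... | yes s = begin
    weight G x S  ≡⟨ weight-yes G x s ⟩
    x ^ᶻ ∣ S ∣    ≡⟨ cong (x ^ᶻ_) size ⟩
    x ^ᶻ ∣ T ∣    ≡⟨ ≡-sym (weight-yes H x (to S⇔T s)) ⟩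
    weight H x T  ∎
... | no ¬s = trans (weight-no G x ¬s) (≡-sym (weight-no H x (¬s ∘ from S⇔T)))

dominating-nonempty : ∀ {n} (G : Graph n) {S} → Dominating G S → Fin n → Nonempty S
dominating-nonempty G {S} dom v with v ∈? S
... | yes v∈S = v , v∈S
... | no v∉S with dom v v∉S
...   | u , u∈S , _ = u , u∈S

≢⊥⇒nonempty : ∀ {n} {S : Subset n} → S ≢ ⊥ → Nonempty S
≢⊥⇒nonempty {S = S} S≢⊥ with nonempty? S
... | yes ne = ne
... | no empty = ⊥-elim (S≢⊥ (Empty-unique empty))

≢⊤⇒missing : ∀ {n} (S : Subset n) → S ≢ ⊤ → Σ (Fin n) (_∉ S)
≢⊤⇒missing [] S≢⊤ = ⊥-elim (S≢⊤ refl)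
≢⊤⇒missing (outside ∷ S) S≢⊤ = zero , λ ()
≢⊤⇒missing (inside ∷ S) S≢⊤ with ≢⊤⇒missing S (S≢⊤ ∘ cong (inside ∷_))
... | v , v∉S = suc v , v∉S ∘ drop-there

-- The edgeless graph Ē_n; its only independent dominating set is the whole vertex set.
edgeless : ∀ n → Graph n
edgeless n = record { adj = λ _ _ → false ; sym = λ _ _ → refl ; irrefl = λ _ → refl }

Di-edgeless : ∀ n x → Di (edgeless n) x ≡ x ^ᶻ n
Di-edgeless n x = begin
    Di (edgeless n) x
  ≡⟨ Di-as-subsetSum (edgeless n) x ⟩
    subsetSum n (weight (edgeless n) x)
  ≡⟨ subsetSum-point n ⊤ (weight (edgeless n) x) (λ S S≢⊤ → weight-no (edgeless n) x (undominated S S≢⊤)) ⟩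
    weight (edgeless n) x ⊤
  ≡⟨ weight-yes (edgeless n) x ((λ _ _ _ _ ()) , (λ v v∉⊤ → ⊥-elim (v∉⊤ ∈⊤))) ⟩
    x ^ᶻ ∣ ⊤ {n} ∣
  ≡⟨ cong (x ^ᶻ_) (∣⊤∣≡n n) ⟩
    x ^ᶻ n ∎
  where
  undominated : ∀ S → S ≢ ⊤ → ¬ IndepDominating (edgeless n) S
  undominated S S≢⊤ (_ , dom) with ≢⊤⇒missing S S≢⊤
  ... | v , v∉S with dom v v∉S
  ...   | _ , _ , ()

joinAdj : ∀ {m n} → Graph m → Graph n → Fin m ⊎ Fin n → Fin m ⊎ Fin n → Bool
joinAdj G H (inj₁ u) (inj₁ v) = adj G u v
joinAdj G H (inj₂ u) (inj₂ v) = adj H u v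
joinAdj G H (inj₁ _) (inj₂ _) = true
joinAdj G H (inj₂ _) (inj₁ _) = true

joinAdj-sym : ∀ {m n} (G : Graph m) (H : Graph n) p q → joinAdj G H p q ≡ joinAdj G H q p
joinAdj-sym G H (inj₁ u) (inj₁ v) = Graph.sym G u v
joinAdj-sym G H (inj₂ u) (inj₂ v) = Graph.sym H u v
joinAdj-sym G H (inj₁ _) (inj₂ _) = refl
joinAdj-sym G H (inj₂ _) (inj₁ _) = refl

joinAdj-irrefl : ∀ {m n} (G : Graph m) (H : Graph n) p → joinAdj G H p p ≡ false
joinAdj-irrefl G H (inj₁ u) = irrefl G u
joinAdj-irrefl G H (inj₂ v) = irrefl H v

_∨_ : ∀ {m n} → Graph m → Graph n → Graph (m N.+ n)
_∨_ {m} G H = record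
  { adj    = λ u v → joinAdj G H (splitAt m u) (splitAt m v)
  ; sym    = λ u v → joinAdj-sym G H (splitAt m u) (splitAt m v)
  ; irrefl = λ v → joinAdj-irrefl G H (splitAt m v)
  }

data Side (m n : ℕ) : Fin (m N.+ n) → Set where
  inG : ∀ i → Side m n (i ↑ˡ n)
  inH : ∀ j → Side m n (m ↑ʳ j)

side : ∀ m {n} (u : Fin (m N.+ n)) → Side m n u
side m u with splitAt m u in eq
... | inj₁ i = subst (Side m _) (splitAt⁻¹-↑ˡ eq) (inG i)
... | inj₂ j = subst (Side m _) (splitAt⁻¹-↑ʳ eq) (inH j)

module _ {m n} (S : Subset m) (T : Subset n) where
  ∈-++⁺ˡ : ∀ {i} → i ∈ S → i ↑ˡ n ∈ S ++ T
  ∈-++⁺ˡ {i} i∈S = lookup⇒[]= _ (S ++ T) (trans (lookup-++ˡ S T i) ([]=⇒lookup i∈S))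

  ∈-++⁻ˡ : ∀ {i} → i ↑ˡ n ∈ S ++ T → i ∈ S
  ∈-++⁻ˡ {i} i∈S++T = lookup⇒[]= i S (trans (≡-sym (lookup-++ˡ S T i)) ([]=⇒lookup i∈S++T))

  ∈-++⁺ʳ : ∀ {j} → j ∈ T → m ↑ʳ j ∈ S ++ T
  ∈-++⁺ʳ {j} j∈T = lookup⇒[]= _ (S ++ T) (trans (lookup-++ʳ S T j) ([]=⇒lookup j∈T))

  ∈-++⁻ʳ : ∀ {j} → m ↑ʳ j ∈ S ++ T → j ∈ T
  ∈-++⁻ʳ {j} j∈S++T = lookup⇒[]= j T (trans (≡-sym (lookup-++ʳ S T j)) ([]=⇒lookup j∈S++T))

∣S++⊥∣ : ∀ {m} n (S : Subset m) → ∣ S ++ ⊥ {n} ∣ ≡ ∣ S ∣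
∣S++⊥∣ n [] = ∣⊥∣≡0 n
∣S++⊥∣ n (outside ∷ S) = ∣S++⊥∣ n S
∣S++⊥∣ n (inside ∷ S) = cong suc (∣S++⊥∣ n S)

∣⊥++T∣ : ∀ m {n} (T : Subset n) → ∣ ⊥ {m} ++ T ∣ ≡ ∣ T ∣
∣⊥++T∣ zero T = refl
∣⊥++T∣ (suc m) T = ∣⊥++T∣ m T

module _ {m n} (G : Graph m) (H : Graph n) where
  adj-inG : ∀ i j → adj (G ∨ H) (i ↑ˡ n) (j ↑ˡ n) ≡ adj G i j
  adj-inG i j rewrite splitAt-↑ˡ m i n | splitAt-↑ˡ m j n = refl

  adj-inH : ∀ i j → adj (G ∨ H) (m ↑ʳ i) (m ↑ʳ j) ≡ adj H i j
  adj-inH i j rewrite splitAt-↑ʳ m n i | splitAt-↑ʳ m n j = refl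

  adj-GH : ∀ i j → Adj (G ∨ H) (i ↑ˡ n) (m ↑ʳ j)
  adj-GH i j rewrite splitAt-↑ˡ m i n | splitAt-↑ʳ m n j = refl

  adj-HG : ∀ j i → Adj (G ∨ H) (m ↑ʳ j) (i ↑ˡ n)
  adj-HG j i = trans (Graph.sym (G ∨ H) _ _) (adj-GH i j)

  -- A set meeting both parts contains an edge of the join.
  ID-∨-both : ∀ {S T} → S ≢ ⊥ → T ≢ ⊥ → ¬ IndepDominating (G ∨ H) (S ++ T)
  ID-∨-both {S} {T} S≢⊥ T≢⊥ (ind , _) with ≢⊥⇒nonempty S≢⊥ | ≢⊥⇒nonempty T≢⊥
  ... | i , i∈S | j , j∈T = ind _ _ (∈-++⁺ˡ S T i∈S) (∈-++⁺ʳ S T j∈T) (adj-GH i j)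

  -- Independent dominating sets of G ∨ H inside the G-part are those of G
  -- (a nonempty set in G dominates all of H; G needs a vertex for this).
  ID-∨-inG : Fin m → ∀ S → IndepDominating (G ∨ H) (S ++ ⊥) ⇔ IndepDominating G S
  ID-∨-inG v₀ S = mk⇔ restrict extend
    where
    restrict : IndepDominating (G ∨ H) (S ++ ⊥) → IndepDominating G S
    restrict (ind , dom) = ind′ , dom′
      where
      ind′ : Independent G S
      ind′ u v u∈S v∈S uv = ind _ _ (∈-++⁺ˡ S ⊥ u∈S) (∈-++⁺ˡ S ⊥ v∈S) (trans (adj-inG u v) uv)
      dom′ : Dominating G S
      dom′ v v∉S with dom (v ↑ˡ n) (v∉S ∘ ∈-++⁻ˡ S ⊥)
      ... | w , w∈ , vw with side m w
      ...   | inG i = i , ∈-++⁻ˡ S ⊥ w∈ , trans (≡-sym (adj-inG v i)) vw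
      ...   | inH j = ⊥-elim (∉⊥ (∈-++⁻ʳ S ⊥ w∈))
    extend : IndepDominating G S → IndepDominating (G ∨ H) (S ++ ⊥)
    extend (ind , dom) = ind′ , dom′
      where
      ind′ : Independent (G ∨ H) (S ++ ⊥)
      ind′ u v u∈ v∈ with side m u | side m v
      ... | inG i | inG j = λ ij → ind i j (∈-++⁻ˡ S ⊥ u∈) (∈-++⁻ˡ S ⊥ v∈) (trans (≡-sym (adj-inG i j)) ij)
      ... | inH i | _     = ⊥-elim (∉⊥ (∈-++⁻ʳ S ⊥ u∈))
      ... | inG _ | inH j = ⊥-elim (∉⊥ (∈-++⁻ʳ S ⊥ v∈))
      dom′ : Dominating (G ∨ H) (S ++ ⊥)
      dom′ v v∉ with side m v
      ... | inG i with dom i (v∉ ∘ ∈-++⁺ˡ S ⊥)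
      ...   | w , w∈S , iw = w ↑ˡ n , ∈-++⁺ˡ S ⊥ w∈S , trans (adj-inG i w) iw
      dom′ v v∉ | inH j with dominating-nonempty G dom v₀
      ...   | w , w∈S = w ↑ˡ n , ∈-++⁺ˡ S ⊥ w∈S , adj-HG j w

  -- Symmetrically for the H-part (H needs a vertex).
  ID-∨-inH : Fin n → ∀ T → IndepDominating (G ∨ H) (⊥ ++ T) ⇔ IndepDominating H T
  ID-∨-inH v₀ T = mk⇔ restrict extend
    where
    restrict : IndepDominating (G ∨ H) (⊥ ++ T) → IndepDominating H T
    restrict (ind , dom) = ind′ , dom′
      where
      ind′ : Independent H T
      ind′ u v u∈T v∈T uv = ind _ _ (∈-++⁺ʳ ⊥ T u∈T) (∈-++⁺ʳ ⊥ T v∈T) (trans (adj-inH u v) uv)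
      dom′ : Dominating H T
      dom′ v v∉T with dom (m ↑ʳ v) (v∉T ∘ ∈-++⁻ʳ ⊥ T)
      ... | w , w∈ , vw with side m w
      ...   | inH j = j , ∈-++⁻ʳ ⊥ T w∈ , trans (≡-sym (adj-inH v j)) vw
      ...   | inG i = ⊥-elim (∉⊥ (∈-++⁻ˡ ⊥ T w∈))
    extend : IndepDominating H T → IndepDominating (G ∨ H) (⊥ ++ T)
    extend (ind , dom) = ind′ , dom′
      where
      ind′ : Independent (G ∨ H) (⊥ ++ T)
      ind′ u v u∈ v∈ with side m u | side m v
      ... | inH i | inH j = λ ij → ind i j (∈-++⁻ʳ ⊥ T u∈) (∈-++⁻ʳ ⊥ T v∈) (trans (≡-sym (adj-inH i j)) ij)
      ... | inG i | _     = ⊥-elim (∉⊥ (∈-++⁻ˡ ⊥ T u∈))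
      ... | inH _ | inG j = ⊥-elim (∉⊥ (∈-++⁻ˡ ⊥ T v∈))
      dom′ : Dominating (G ∨ H) (⊥ ++ T)
      dom′ v v∉ with side m v
      ... | inH j with dom j (v∉ ∘ ∈-++⁺ʳ ⊥ T)
      ...   | w , w∈T , jw = m ↑ʳ w , ∈-++⁺ʳ ⊥ T w∈T , trans (adj-inH j w) jw
      dom′ v v∉ | inG i with dominating-nonempty H dom v₀
      ...   | w , w∈T = m ↑ʳ w , ∈-++⁺ʳ ⊥ T w∈T , adj-GH i w

Di-∨ : ∀ {m n} (G : Graph (suc m)) (H : Graph (suc n)) x → Di (G ∨ H) x ≡ Di G x + Di H x
Di-∨ {m} {n} G H x = begin
    Di (G ∨ H) x
  ≡⟨ Di-as-subsetSum (G ∨ H) x ⟩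
    subsetSum (suc m N.+ suc n) w
  ≡⟨ subsetSum-++ (suc m) (suc n) w ⟩
    subsetSum (suc m) (λ S → subsetSum (suc n) (λ T → w (S ++ T)))
  ≡⟨ subsetSum-cross (suc m) (suc n) (λ S T → w (S ++ T))
       (λ S T S≢⊥ T≢⊥ → weight-no (G ∨ H) x (ID-∨-both G H S≢⊥ T≢⊥)) ⟩
    subsetSum (suc m) (λ S → w (S ++ ⊥ {suc n})) + subsetSum (suc n) (λ T → w (⊥ {suc m} ++ T)) - w (⊥ {suc m} ++ ⊥ {suc n})
  ≡⟨ cong₂ _-_ (cong₂ _+_ G-part H-part) no-empty-set ⟩
    Di G x + Di H x - + 0
  ≡⟨ ℤP.+-identityʳ (Di G x + Di H x) ⟩
    Di G x + Di H x ∎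
  where
  w : Subset (suc m N.+ suc n) → ℤ
  w = weight (G ∨ H) x
  G-part : subsetSum (suc m) (λ S → w (S ++ ⊥ {suc n})) ≡ Di G x
  G-part = trans
    (subsetSum-cong (suc m) (λ S → weight-transfer (G ∨ H) G x (ID-∨-inG G H zero S) (∣S++⊥∣ (suc n) S)))
    (≡-sym (Di-as-subsetSum G x))
  H-part : subsetSum (suc n) (λ T → w (⊥ {suc m} ++ T)) ≡ Di H x
  H-part = trans
    (subsetSum-cong (suc n) (λ T → weight-transfer (G ∨ H) H x (ID-∨-inH G H zero T) (∣⊥++T∣ (suc m) T)))
    (≡-sym (Di-as-subsetSum H x))
  -- the empty set dominates no vertex of G
  no-empty-set : w (⊥ {suc m} ++ ⊥ {suc n}) ≡ + 0
  no-empty-set = weight-no (G ∨ H) x (λ id → ∉⊥ (proj₂ (dominating-nonempty G (proj₂ (to (ID-∨-inG G H zero ⊥) id)) zero)))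

_++ʷ_ : ∀ {n} {G : Graph n} {u v w} → Walk G u v → Walk G v w → Walk G u w
here ++ʷ q = q
step uv p ++ʷ q = step uv (p ++ʷ q)

-- The join of two nonempty graphs is connected: every vertex is within two
-- steps of the first vertex h₀ of H, passing through the first vertex g₀ of G.
∨-connected : ∀ {m n} (G : Graph (suc m)) (H : Graph (suc n)) → Connected (G ∨ H)
∨-connected {m} {n} G H = (h₀ , tt) , λ u v → toHub u ++ʷ fromHub v
  where
  g₀ h₀ : Fin (suc m N.+ suc n)
  g₀ = zero ↑ˡ suc n
  h₀ = suc m ↑ʳ zero
  toHub : ∀ u → Walk (G ∨ H) u h₀
  toHub u with side (suc m) u
  ... | inG i = step (adj-GH G H i zero) here
  ... | inH j = step {w = g₀} (adj-HG G H j zero) (step (adj-GH G H zero zero) here)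
  fromHub : ∀ v → Walk (G ∨ H) h₀ v
  fromHub v with side (suc m) v
  ... | inG i = step (adj-HG G H zero i) here
  ... | inH j = step {w = g₀} (adj-HG G H zero zero) (step (adj-GH G H zero j) here)

-- H ∨ (H ∨ (… ∨ G)) with k copies of H, and its number of vertices minus one.
copiesSize : ℕ → ℕ → ℕ → ℕ
copiesSize zero    a n = n
copiesSize (suc k) a n = a N.+ suc (copiesSize k a n)

joinCopies : ∀ {a n} (k : ℕ) → Graph (suc a) → Graph (suc n) → Graph (suc (copiesSize k a n))
joinCopies zero    H G = G
joinCopies (suc k) H G = H ∨ joinCopies k H G

Di-joinCopies : ∀ {a n} k (H : Graph (suc a)) (G : Graph (suc n)) x →
  Di (joinCopies k H G) x ≡ + k * Di H x + Di G x
Di-joinCopies zero    H G x = ≡-sym (ℤP.+-identityˡ (Di G x))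
Di-joinCopies (suc k) H G x = begin
    Di (H ∨ joinCopies k H G) x
  ≡⟨ Di-∨ H (joinCopies k H G) x ⟩
    Di H x + Di (joinCopies k H G) x
  ≡⟨ cong (λ t → Di H x + t) (Di-joinCopies k H G x) ⟩
    Di H x + (+ k * Di H x + Di G x)
  ≡⟨ one-more (+ k) (Di H x) (Di G x) ⟩
    + suc k * Di H x + Di G x ∎
  where
  one-more : ∀ c h g → h + (c * h + g) ≡ (+ 1 + c) * h + g
  one-more = solve-∀

joinCopies-connected : ∀ {a n} k (H : Graph (suc a)) (G : Graph (suc n)) →
  Connected G → Connected (joinCopies k H G)
joinCopies-connected zero    H G conn = conn
joinCopies-connected (suc k) H G conn = ∨-connected H (joinCopies k H G)

P₃ : Graph 3
P₃ = edgeless 2 ∨ edgeless 1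

Di-P₃ : ∀ x → Di P₃ x ≡ x * x + x
Di-P₃ x = begin
    Di P₃ x
  ≡⟨ Di-∨ (edgeless 2) (edgeless 1) x ⟩
    Di (edgeless 2) x + Di (edgeless 1) x
  ≡⟨ cong₂ _+_ (Di-edgeless 2 x) (Di-edgeless 1 x) ⟩
    x * (x * + 1) + x * + 1
  ≡⟨ normalise x ⟩
    x * x + x ∎
  where
  normalise : ∀ x → x * (x * + 1) + x * + 1 ≡ x * x + x
  normalise = solve-∀

Di-stackOnP₃ : ∀ {a} k (H : Graph (suc a)) x → Di (joinCopies k H P₃) x ≡ + k * Di H x + (x * x + x)
Di-stackOnP₃ k H x = trans (Di-joinCopies k H P₃ x) (cong (λ t → + k * Di H x + t) (Di-P₃ x))

stackOnP₃-connected : ∀ {a} k (H : Graph (suc a)) → Connected (joinCopies k H P₃)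
stackOnP₃-connected k H = joinCopies-connected k H P₃ (∨-connected (edgeless 2) (edgeless 1))

mainTheorem1 : ((m : ℤ) → Σ ℕ (λ n → Σ (Graph n) (λ G → Connected G × Di G (- (+ 1)) ≡ m)))
    × ((k : ℕ) → Σ ℕ (λ n → Σ (Graph n) (λ G → Connected G × Di G -[1+ k ] ≡ + 0)))
mainTheorem1 = realise , root
  where
  -- p copies of Ē₂ (D_i(Ē₂, -1) = 1) give p; q + 1 copies of K₁ (D_i(K₁, -1) = -1) give -(q + 1)
  realise : (m : ℤ) → Σ ℕ (λ n → Σ (Graph n) (λ G → Connected G × Di G (- (+ 1)) ≡ m))
  realise (+ p) = _ , joinCopies p (edgeless 2) P₃ , stackOnP₃-connected p (edgeless 2) ,
    trans (Di-stackOnP₃ p (edgeless 2) (- (+ 1)))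
          (trans (cong (λ t → + p * t + + 0) (Di-edgeless 2 (- (+ 1)))) (count-up (+ p)))
    where
    count-up : ∀ c → c * + 1 + + 0 ≡ c
    count-up = solve-∀
  realise -[1+ q ] = _ , joinCopies (suc q) (edgeless 1) P₃ , stackOnP₃-connected (suc q) (edgeless 1) ,
    trans (Di-stackOnP₃ (suc q) (edgeless 1) (- (+ 1)))
          (trans (cong (λ t → + suc q * t + + 0) (Di-edgeless 1 (- (+ 1)))) (count-down (+ suc q)))
    where
    count-down : ∀ c → c * - + 1 + + 0 ≡ - c
    count-down = solve-∀
  -- k copies of K₁: D_i = kx + x² + x = x(x + k + 1), which vanishes at x = -(k + 1)
  root : (k : ℕ) → Σ ℕ (λ n → Σ (Graph n) (λ G → Connected G × Di G -[1+ k ] ≡ + 0))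
  root k = _ , joinCopies k (edgeless 1) P₃ , stackOnP₃-connected k (edgeless 1) ,
    trans (Di-stackOnP₃ k (edgeless 1) -[1+ k ])
          (trans (cong (λ t → + k * t + (-[1+ k ] * -[1+ k ] + -[1+ k ])) (Di-edgeless 1 -[1+ k ]))
                 (vanishes (+ k)))
    where
    vanishes : ∀ c → c * (- (+ 1 + c) * + 1) + (- (+ 1 + c) * - (+ 1 + c) + - (+ 1 + c)) ≡ + 0
    vanishes = solve-∀
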